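{- For all Plotkin terms $t$, values $v$ and variables $x$: if $t\{x:=v\}\Downarrow_kn$ then there exist $k'$ and $n'$ such that $t\Downarrow_{k'}n'$ and $n'\{x:=v\}\Downarrow_{k-k'}n$.
   Context: Plotkin terms $t::=v\mid tu$, values $v::=x\mid\lambda x.t$; $t\{x:=v\}$ is capture-avoiding substitution. Root rule $(\lambda x.t)v\mapsto t\{x:=v\}$ ($v$ value); weak reduction $\to_w$: closure under $W::=\langle\cdot\rangle\mid tW\mid Wt$. Big-step $t\Downarrow_kn$: $v\Downarrow_0v$; if $t\Downarrow_k\lambda x.s$, $u\Downarrow_hv$ ($v$ value), $s\{x:=v\}\Downarrow_in$ then $tu\Downarrow_{k+h+i+1}n$; if $t\Downarrow_kn$, $u\Downarrow_hn'$ and $nn'$ is $\to_w$-normal then $tu\Downarrow_{k+h}nn'$ (equivalently, $t\Downarrow_kn$ iff $t\to_w^kn$ with $n$ $\to_w$-normal). -}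

module Defs where

open import Data.Nat using (ℕ; zero; suc; _+_; _≟_)
open import Data.Product using (∃)
open import Relation.Nullary using (¬_; yes; no)

-- Plotkin (untyped, weak call-by-value) λ-terms, with variables as
-- de Bruijn indices (terms are thus taken up to α-equivalence).
data Term : Set where
  var : ℕ → Term
  lam : Term → Term
  app : Term → Term → Term

data Value : Term → Set where
  var : ∀ x → Value (var x)
  lam : ∀ t → Value (lam t)

ext : (ℕ → ℕ) → ℕ → ℕ
ext ρ zero    = zero
ext ρ (suc y) = suc (ρ y)

rename : (ℕ → ℕ) → Term → Term
rename ρ (var y)   = var (ρ y)
rename ρ (lam t)   = lam (rename (ext ρ) t)
rename ρ (app t u) = app (rename ρ t) (rename ρ u)

exts : (ℕ → Term) → ℕ → Term
exts σ zero    = var zero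
exts σ (suc y) = rename suc (σ y)

subst : (ℕ → Term) → Term → Term
subst σ (var y)   = σ y
subst σ (lam t)   = lam (subst (exts σ) t)
subst σ (app t u) = app (subst σ t) (subst σ u)

-- t{x:=v} : replace the free variable x by v (other free variables unchanged)
single : ℕ → Term → ℕ → Term
single x v y with y ≟ x
... | yes _ = v
... | no  _ = var y

_[_≔_] : Term → ℕ → Term → Term
t [ x ≔ v ] = subst (single x v) t

β-sub : Term → ℕ → Term
β-sub v zero    = v
β-sub v (suc y) = var y

_[0≔_] : Term → Term → Term
t [0≔ v ] = subst (β-sub v) t

infix 4 _→w_
data _→w_ : Term → Term → Set where
  root : ∀ {t v} → Value v → app (lam t) v →w t [0≔ v ]
  appR : ∀ {t u u'} → u →w u' → app t u →w app t u'
  appL : ∀ {t t' u} → t →w t' → app t u →w app t' u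

Normal : Term → Set
Normal t = ∀ t' → ¬ (t →w t')

data _⇓[_]_ : Term → ℕ → Term → Set where
  ⇓val  : ∀ {v} → Value v → v ⇓[ 0 ] v
  ⇓β    : ∀ {t u s v n k h i} →
          t ⇓[ k ] lam s → u ⇓[ h ] v → Value v → (s [0≔ v ]) ⇓[ i ] n →
          app t u ⇓[ k + h + i + 1 ] n
  ⇓stuck : ∀ {t u n n' k h} →
          t ⇓[ k ] n → u ⇓[ h ] n' → Normal (app n n') →
          app t u ⇓[ k + h ] app n n'

-- Generalise from t{x:=v} to t under any substitution σ sending every variable to a value,
-- and induct on the evaluation of σ t. In an application t₁ t₂, first factorise the
-- evaluations of the two sides through the results m₁, m₂ of t₁, t₂. If m₁ m₂ is a β-redex,
-- then σ m₁ and σ m₂ are values, so their remaining evaluations take no steps, and since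
-- substitution commutes with β the induction hypothesis applies to the contractum.
-- Otherwise m₁ m₂ is stuck, so t₁ t₂ already evaluates to m₁ m₂ and the rest of the
-- evaluation of σ (t₁ t₂) continues from σ m₁ and σ m₂.
module Submission where

open import Defs
open import Data.Nat using (ℕ; zero; suc; _+_; _≤_; _∸_; _≟_)
open import Data.Nat.Properties using (m≤m+n; m+n∸m≡n)
open import Data.Nat.Tactic.RingSolver using (solve-∀)
open import Data.Product using (Σ; _×_; _,_)
open import Data.Empty using (⊥-elim)
open import Function using (_∘_; id)
open import Relation.Nullary using (¬_; Dec; yes; no)
open import Relation.Binary.PropositionalEquality
  using (_≡_; _≗_; refl; sym; trans; cong; cong₂)
  renaming (subst to ≡-subst)

ext-cong : ∀ {ρ ρ'} → ρ ≗ ρ' → ext ρ ≗ ext ρ'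
ext-cong eq zero    = refl
ext-cong eq (suc y) = cong suc (eq y)

rename-cong : ∀ {ρ ρ'} → ρ ≗ ρ' → rename ρ ≗ rename ρ'
rename-cong eq (var y)   = cong var (eq y)
rename-cong eq (lam t)   = cong lam (rename-cong (ext-cong eq) t)
rename-cong eq (app t u) = cong₂ app (rename-cong eq t) (rename-cong eq u)

exts-cong : ∀ {σ τ} → σ ≗ τ → exts σ ≗ exts τ
exts-cong eq zero    = refl
exts-cong eq (suc y) = cong (rename suc) (eq y)

subst-cong : ∀ {σ τ} → σ ≗ τ → subst σ ≗ subst τ
subst-cong eq (var y)   = eq y
subst-cong eq (lam t)   = cong lam (subst-cong (exts-cong eq) t)
subst-cong eq (app t u) = cong₂ app (subst-cong eq t) (subst-cong eq u)

ext-∘ : ∀ ρ ρ' → ext ρ ∘ ext ρ' ≗ ext (ρ ∘ ρ')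
ext-∘ ρ ρ' zero    = refl
ext-∘ ρ ρ' (suc y) = refl

rename-rename : ∀ ρ ρ' → rename ρ ∘ rename ρ' ≗ rename (ρ ∘ ρ')
rename-rename ρ ρ' (var y)   = refl
rename-rename ρ ρ' (lam t)   =
  cong lam (trans (rename-rename (ext ρ) (ext ρ') t) (rename-cong (ext-∘ ρ ρ') t))
rename-rename ρ ρ' (app t u) = cong₂ app (rename-rename ρ ρ' t) (rename-rename ρ ρ' u)

exts-ext : ∀ σ ρ → exts σ ∘ ext ρ ≗ exts (σ ∘ ρ)
exts-ext σ ρ zero    = refl
exts-ext σ ρ (suc y) = refl

subst-rename : ∀ σ ρ → subst σ ∘ rename ρ ≗ subst (σ ∘ ρ)
subst-rename σ ρ (var y)   = refl
subst-rename σ ρ (lam t)   =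
  cong lam (trans (subst-rename (exts σ) (ext ρ) t) (subst-cong (exts-ext σ ρ) t))
subst-rename σ ρ (app t u) = cong₂ app (subst-rename σ ρ t) (subst-rename σ ρ u)

ext-exts : ∀ ρ σ → rename (ext ρ) ∘ exts σ ≗ exts (rename ρ ∘ σ)
ext-exts ρ σ zero    = refl
ext-exts ρ σ (suc y) = trans (rename-rename (ext ρ) suc (σ y)) (sym (rename-rename suc ρ (σ y)))

rename-subst : ∀ ρ σ → rename ρ ∘ subst σ ≗ subst (rename ρ ∘ σ)
rename-subst ρ σ (var y)   = refl
rename-subst ρ σ (lam t)   =
  cong lam (trans (rename-subst (ext ρ) (exts σ) t) (subst-cong (ext-exts ρ σ) t))
rename-subst ρ σ (app t u) = cong₂ app (rename-subst ρ σ t) (rename-subst ρ σ u)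

exts-exts : ∀ τ σ → subst (exts τ) ∘ exts σ ≗ exts (subst τ ∘ σ)
exts-exts τ σ zero    = refl
exts-exts τ σ (suc y) = trans (subst-rename (exts τ) suc (σ y)) (sym (rename-subst suc τ (σ y)))

subst-subst : ∀ τ σ → subst τ ∘ subst σ ≗ subst (subst τ ∘ σ)
subst-subst τ σ (var y)   = refl
subst-subst τ σ (lam t)   =
  cong lam (trans (subst-subst (exts τ) (exts σ) t) (subst-cong (exts-exts τ σ) t))
subst-subst τ σ (app t u) = cong₂ app (subst-subst τ σ t) (subst-subst τ σ u)

exts-var : exts var ≗ var
exts-var zero    = refl
exts-var (suc y) = refl

subst-var : subst var ≗ id
subst-var (var y)   = refl
subst-var (lam t)   = cong lam (trans (subst-cong exts-var t) (subst-var t))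
subst-var (app t u) = cong₂ app (subst-var t) (subst-var u)

subst-[0≔] : ∀ σ s m → subst σ (s [0≔ m ]) ≡ subst (exts σ) s [0≔ subst σ m ]
subst-[0≔] σ s m = trans (subst-subst σ (β-sub m) s)
  (trans (subst-cong pointwise s) (sym (subst-subst (β-sub (subst σ m)) (exts σ) s)))
  where
  pointwise : subst σ ∘ β-sub m ≗ subst (β-sub (subst σ m)) ∘ exts σ
  pointwise zero    = refl
  pointwise (suc y) = sym (trans (subst-rename (β-sub (subst σ m)) suc (σ y)) (subst-var (σ y)))

value? : ∀ t → Dec (Value t)
value? (var y)   = yes (var y)
value? (lam t)   = yes (lam t)
value? (app t u) = no λ ()

data Redex : Term → Term → Set where
  redex : ∀ {s v} → Value v → Redex (lam s) v

redex? : ∀ t u → Dec (Redex t u)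
redex? (var y)   u = no λ ()
redex? (app _ _) u = no λ ()
redex? (lam s)   u with value? u
... | yes u-value = yes (redex u-value)
... | no ¬u-value = no λ { (redex u-value) → ¬u-value u-value }

Value⇒Normal : ∀ {t} → Value t → Normal t
Value⇒Normal (var y) _ ()
Value⇒Normal (lam t) _ ()

app-normal : ∀ {t u} → Normal t → Normal u → ¬ Redex t u → Normal (app t u)
app-normal nt nu ¬r _ (root v) = ¬r (redex v)
app-normal nt nu ¬r _ (appR r) = nu _ r
app-normal nt nu ¬r _ (appL r) = nt _ r

⇓-normal : ∀ {t k n} → t ⇓[ k ] n → Normal n
⇓-normal (⇓val v)          = Value⇒Normal v
⇓-normal (⇓β _ _ _ d)      = ⇓-normal d
⇓-normal (⇓stuck _ _ nmn') = nmn'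

Value-⇓ : ∀ {v k n} → Value v → v ⇓[ k ] n → k ≡ 0 × n ≡ v
Value-⇓ _ (⇓val _) = refl , refl

⇓-app-stuck : ∀ {t u k h m m'} →
  t ⇓[ k ] m → u ⇓[ h ] m' → ¬ Redex m m' → app t u ⇓[ k + h ] app m m'
⇓-app-stuck dt du ¬r = ⇓stuck dt du (app-normal (⇓-normal dt) (⇓-normal du) ¬r)

⇓-cast : ∀ {t k k' n} → k ≡ k' → t ⇓[ k ] n → t ⇓[ k' ] n
⇓-cast = ≡-subst (λ k → _ ⇓[ k ] _)

+-interchange : ∀ a b c d → (a + b) + (c + d) ≡ (a + c) + (b + d)
+-interchange = solve-∀

+-interchange-suc : ∀ a b c d i → (a + b) + (c + d + i + 1) ≡ (a + c) + (b + d) + i + 1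
+-interchange-suc = solve-∀

+-β-split : ∀ a c i j → (a + c + i + 1) + j ≡ (a + 0) + (c + 0) + (i + j) + 1
+-β-split = solve-∀

record Factorisation (σ : ℕ → Term) (t : Term) (k : ℕ) (n : Term) : Set where
  constructor factorisation
  field
    steps₁ steps₂ : ℕ
    middle        : Term
    steps-sum     : steps₁ + steps₂ ≡ k
    eval₁         : t ⇓[ steps₁ ] middle
    eval₂         : subst σ middle ⇓[ steps₂ ] n

module _ {σ : ℕ → Term} (σ-value : ∀ y → Value (σ y)) where

  subst-value : ∀ {t} → Value t → Value (subst σ t)
  subst-value (var y) = σ-value y
  subst-value (lam t) = lam _

  factorise-β : ∀ {t₁ t₂ s w n k h i} →
    Factorisation σ t₁ k (lam s) → Factorisation σ t₂ h w → Value w →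
    (s [0≔ w ]) ⇓[ i ] n → (∀ r → s [0≔ w ] ≡ subst σ r → Factorisation σ r i n) →
    Factorisation σ (app t₁ t₂) (k + h + i + 1) n
  factorise-β {i = i} (factorisation k₁ k₂ m₁ refl e₁ f₁) (factorisation h₁ h₂ m₂ refl e₂ f₂)
              w-value d IH with redex? m₁ m₂
  ... | no ¬r = factorisation (k₁ + h₁) (k₂ + h₂ + i + 1) (app m₁ m₂)
        (+-interchange-suc k₁ h₁ k₂ h₂ i) (⇓-app-stuck e₁ e₂ ¬r) (⇓β f₁ f₂ w-value d)
  ... | yes (redex {s'} m₂-value)
      with Value-⇓ (lam _) f₁ | Value-⇓ (subst-value m₂-value) f₂
  ... | refl , refl | refl , refl
      with IH (s' [0≔ m₂ ]) (sym (subst-[0≔] σ s' m₂))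
  ... | factorisation i₁ i₂ m refl e f = factorisation (k₁ + h₁ + i₁ + 1) i₂ m
        (+-β-split k₁ h₁ i₁ i₂) (⇓β e₁ e₂ m₂-value e) f

  factorise-stuck : ∀ {t₁ t₂ n₁ n₂ k h} →
    Factorisation σ t₁ k n₁ → Factorisation σ t₂ h n₂ → Normal (app n₁ n₂) →
    Factorisation σ (app t₁ t₂) (k + h) (app n₁ n₂)
  factorise-stuck (factorisation k₁ k₂ m₁ refl e₁ f₁) (factorisation h₁ h₂ m₂ refl e₂ f₂)
                  normal with redex? m₁ m₂
  ... | no ¬r = factorisation (k₁ + h₁) (k₂ + h₂) (app m₁ m₂)
        (+-interchange k₁ h₁ k₂ h₂) (⇓-app-stuck e₁ e₂ ¬r) (⇓stuck f₁ f₂ normal)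
  ... | yes (redex m₂-value)
      with Value-⇓ (lam _) f₁ | Value-⇓ (subst-value m₂-value) f₂
  ... | refl , refl | refl , refl = ⊥-elim (normal _ (root (subst-value m₂-value)))

  -- The equation T ≡ subst σ t lets the induction run on the derivation, whose
  -- β-premise is about a contractum that is not a subterm of t.
  factorise : ∀ {T k n} → T ⇓[ k ] n → ∀ t → T ≡ subst σ t → Factorisation σ t k n
  factorise d (var y) refl = factorisation 0 _ (var y) refl (⇓val (var y)) d
  factorise d (lam s) refl = factorisation 0 _ (lam s) refl (⇓val (lam s)) d
  factorise (⇓β d₁ d₂ w-value d₃) (app t₁ t₂) refl =
    factorise-β (factorise d₁ t₁ refl) (factorise d₂ t₂ refl) w-value d₃ (factorise d₃)
  factorise (⇓stuck d₁ d₂ normal) (app t₁ t₂) refl =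
    factorise-stuck (factorise d₁ t₁ refl) (factorise d₂ t₂ refl) normal

single-value : ∀ {v} → Value v → ∀ x y → Value (single x v y)
single-value v-value x y with y ≟ x
... | yes _ = v-value
... | no  _ = var y

lemma7p5 : (t v : Term) (x : ℕ) → Value v → (k : ℕ) (n : Term) →
    (t [ x ≔ v ]) ⇓[ k ] n →
    Σ ℕ λ k' → Σ Term λ n' → k' ≤ k × t ⇓[ k' ] n' × (n' [ x ≔ v ]) ⇓[ k ∸ k' ] n
lemma7p5 t v x v-value k n d
  with factorise (single-value v-value x) d t refl
... | factorisation k₁ k₂ m refl e f =
  k₁ , m , m≤m+n k₁ k₂ , e , ⇓-cast (sym (m+n∸m≡n k₁ k₂)) f
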